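{- Let $\mathcal{K}$ be a non-degenerate coronoid with perimeters $C_1,\dots,C_k$, and let $\mathbf{n}=(n_1,\dots,n_k)\neq\mathbf{0}$ be a vector of non-negative integers. Then the proper generalised altan $A^{\mathbf{n}}(\mathcal{K})=A^{\mathbf{n}}(G(\mathcal{K});C_1,\dots,C_k)$, with its natural plane embedding (each new cycle drawn inside the corresponding hole), is not a coronoid: not all of its faces (those of $\mathcal{K}$ together with the newly created faces) are hexagons.
   Context: $\mathcal{H}$ denotes the set of hexagons of the regular hexagonal tiling of the plane; hexagons are adjacent if distinct and share an edge; a finite set of hexagons is connected if non-empty and any two are joined by a sequence of its hexagons, consecutive ones adjacent. A coronoid is a finite connected $\mathcal{K}\subseteq\mathcal{H}$; its corona holes are the finite connected components of $\mathcal{H}\setminus\mathcal{K}$; it is non-degenerate if no corona hole is a single hexagon. $G(\mathcal{K})$ is the subgraph of the hexagonal lattice of all vertices and edges lying on some hexagon of $\mathcal{K}$. Edges lying on exactly one hexagon of $\mathcal{K}$ and vertices not incident to three edges each lying on two hexagons of $\mathcal{K}$ are boundary edges/vertices; they form disjoint cycles, the perimeters (one outer perimeter and one for each corona hole). Altan: if $H$ is a graph and $C$ a cycle containing $d\ge2$ degree-2 vertices $v_1,\dots,v_d$ of $H$ in cyclic order, $A(H,C)$ adds a new cycle $w_1x_1\cdots w_dx_dw_1$ on $2d$ new vertices and edges $v_iw_i$. $A^{\mathbf{n}}(H;C_1,\dots,C_k)$ performs the altan operation $n_i$ times at position $i$, each time replacing the cycle in position $i$ by the newly created cycle. -}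

module Defs where

open import Data.Bool using (Bool; true; false; _∧_; _∨_; if_then_else_)
open import Data.Nat using (ℕ; zero; suc; _≤_; _∸_; _<ᵇ_; _≡ᵇ_)
import Data.Nat as N
open import Data.Integer using (ℤ; 0ℤ; 1ℤ; -[1+_]) renaming (_+_ to _+ℤ_; _-_ to _-ℤ_)
import Data.Integer.Properties as ℤP
import Data.Nat.Properties as NP
import Data.Bool.Properties as BP
open import Data.Product using (_×_; _,_; proj₁; proj₂)
import Data.Product.Properties as PP
open import Data.Sum using (_⊎_; inj₁; inj₂)
import Data.Sum.Properties as SP
open import Data.Bool.ListAction using (any)
open import Data.List using (List; []; _∷_; _++_; length; filterᵇ; map; zip; take; drop; upTo; concatMap)
open import Data.List.Relation.Unary.All using (All)
open import Data.List.Relation.Unary.Any using (Any)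
open import Data.List.Relation.Unary.AllPairs using (AllPairs)
open import Data.List.Relation.Unary.Unique.Propositional using (Unique)
open import Data.List.Relation.Binary.Disjoint.Propositional using (Disjoint)
open import Data.List.Membership.Propositional using (_∈_; _∉_)
open import Data.Vec using (Vec; toList)
open import Relation.Binary.PropositionalEquality using (_≡_; _≢_)
open import Relation.Binary.Definitions using (DecidableEquality)
open import Relation.Nullary using (¬_; ⌊_⌋)

-- The hexagonal tiling H.
-- Hexagons are indexed by axial coordinates (a , b) ∈ ℤ².
-- The six neighbours of (a , b) are (a , b) + d for d in 'dirs'.

Hex : Set
Hex = ℤ × ℤ

-1ℤ : ℤ
-1ℤ = -[1+ 0 ]

dirs : List Hex
dirs = (1ℤ , 0ℤ) ∷ (-1ℤ , 0ℤ) ∷ (0ℤ , 1ℤ) ∷ (0ℤ , -1ℤ)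
     ∷ (1ℤ , -1ℤ) ∷ (-1ℤ , 1ℤ) ∷ []

_⊕_ : Hex → Hex → Hex
(a , b) ⊕ (c , d) = (a +ℤ c , b +ℤ d)

Adj : Hex → Hex → Set
Adj h h' = Any (λ d → h' ≡ h ⊕ d) dirs

_≟H_ : DecidableEquality Hex
_≟H_ = PP.≡-dec ℤP._≟_ ℤP._≟_

_∈ᵇH_ : Hex → List Hex → Bool
h ∈ᵇH L = any (λ h' → ⌊ h ≟H h' ⌋) L

data Walk (P : Hex → Set) : Hex → Hex → Set where
  here  : ∀ {h} → P h → Walk P h h
  step  : ∀ {h h' h''} → P h → Adj h h' → Walk P h' h'' → Walk P h h''

-- A finite set of hexagons is represented by a list.
Connected : List Hex → Set
Connected K = (K ≢ []) × (∀ h h' → h ∈ K → h' ∈ K → Walk (_∈ K) h h')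

Coronoid : List Hex → Set
Coronoid K = Connected K

ReachOut : List Hex → Hex → Hex → Set
ReachOut K h h' = Walk (_∉ K) h h'

-- A corona hole consisting of a single hexagon h: h ∉ K and its component
-- of H \ K is exactly {h} (such a component is automatically finite).
SingleHexHole : List Hex → Hex → Set
SingleHexHole K h = (h ∉ K) × (∀ h' → ReachOut K h h' → h' ≡ h)

NonDegenerate : List Hex → Set
NonDegenerate K = ∀ h → ¬ SingleHexHole K h

-- Vertices of the hexagonal lattice: each vertex is a corner of exactly
-- three mutually adjacent hexagons.  (a , b , false) ("up") is the common
-- corner of (a,b), (a+1,b), (a,b+1); (a , b , true) ("down") is the common
-- corner of (a+1,b), (a,b+1), (a+1,b+1).

LVertex : Set
LVertex = ℤ × ℤ × Bool

_≟L_ : DecidableEquality LVertex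
_≟L_ = PP.≡-dec ℤP._≟_ (PP.≡-dec ℤP._≟_ BP._≟_)

hexesOf : LVertex → List Hex
hexesOf (a , b , false) = (a , b) ∷ (a +ℤ 1ℤ , b) ∷ (a , b +ℤ 1ℤ) ∷ []
hexesOf (a , b , true)  = (a +ℤ 1ℤ , b) ∷ (a , b +ℤ 1ℤ) ∷ (a +ℤ 1ℤ , b +ℤ 1ℤ) ∷ []

nbrs : LVertex → List LVertex
nbrs (a , b , false) = (a , b , true) ∷ (a -ℤ 1ℤ , b , true) ∷ (a , b -ℤ 1ℤ , true) ∷ []
nbrs (a , b , true)  = (a , b , false) ∷ (a +ℤ 1ℤ , b , false) ∷ (a , b +ℤ 1ℤ , false) ∷ []

-- the six corners of a hexagon, in cyclic order
corners : Hex → List LVertex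
corners (a , b) =
  (a , b , false) ∷ (a -ℤ 1ℤ , b , true) ∷ (a -ℤ 1ℤ , b , false)
  ∷ (a -ℤ 1ℤ , b -ℤ 1ℤ , true) ∷ (a , b -ℤ 1ℤ , false) ∷ (a , b -ℤ 1ℤ , true) ∷ []

-- number of hexagons of K on which the lattice edge uv lies
-- (the hexagons containing both endpoints)
kCount : List Hex → LVertex → LVertex → ℕ
kCount K u v = length (filterᵇ (λ h → (h ∈ᵇH hexesOf v) ∧ (h ∈ᵇH K)) (hexesOf u))

BoundaryEdge : List Hex → LVertex → LVertex → Set
BoundaryEdge K u v = (v ∈ nbrs u) × (kCount K u v ≡ 1)

-- degree of v in G(K): number of lattice edges at v lying on some hexagon of K
baseDeg : List Hex → LVertex → ℕ
baseDeg K u = length (filterᵇ (λ v → 0 <ᵇ kCount K u v) (nbrs u))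

-- Cycles are given as lists of vertices in cyclic order.

cycPairs : ∀ {A : Set} → List A → List (A × A)
cycPairs []       = []
cycPairs (x ∷ xs) = zip (x ∷ xs) (xs ++ x ∷ [])

IsBoundaryCycle : List Hex → List LVertex → Set
IsBoundaryCycle K C =
  (3 ≤ length C) × Unique C × All (λ e → BoundaryEdge K (proj₁ e) (proj₂ e)) (cycPairs C)

-- Cs is the list C₁,…,C_k of (all) perimeters of K: pairwise disjoint
-- boundary cycles covering every boundary edge (the boundary edges form
-- disjoint cycles, so these are exactly its components).
Perimeters : List Hex → List (List LVertex) → Set
Perimeters K Cs =
  All (IsBoundaryCycle K) Cs × AllPairs Disjoint Cs
  × (∀ u v → BoundaryEdge K u v →
       Any (λ C → ((u , v) ∈ cycPairs C) ⊎ ((v , u) ∈ cycPairs C)) Cs)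

-- Vertices: lattice vertices, or new vertices inj₂ (p , s , i , k):
-- created at position p, in the s-th altan step at that position,
-- with index i; k = false for w_i, k = true for x_i.

AVert : Set
AVert = LVertex ⊎ (ℕ × ℕ × ℕ × Bool)

_≟A_ : DecidableEquality AVert
_≟A_ = SP.≡-dec _≟L_ (PP.≡-dec NP._≟_ (PP.≡-dec NP._≟_ (PP.≡-dec NP._≟_ BP._≟_)))

-- The graph is G(K) together with a list E of extra (new) edges.
Edges : Set
Edges = List (AVert × AVert)

deg : List Hex → Edges → AVert → ℕ
deg K E v = base v N.+ length (filterᵇ (λ e → ⌊ proj₁ e ≟A v ⌋ ∨ ⌊ proj₂ e ≟A v ⌋) E)
  where
  base : AVert → ℕ
  base (inj₁ u) = baseDeg K u
  base (inj₂ _) = 0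

at : List ℕ → ℕ → ℕ
at []       _       = 0
at (x ∷ xs) zero    = x
at (x ∷ xs) (suc i) = at xs i

record AltanResult : Set where
  field
    newEdges : Edges
    newCycle : List AVert
    newFaces : List (List AVert)   -- each face as its boundary cycle

-- One altan operation A(H, C), H = G(K) + E, at position p, step s.
-- v_1..v_d are the degree-2 vertices of H on C in cyclic order;
-- new cycle w_1 x_1 … w_d x_d, edges v_i w_i.  In the natural embedding
-- (new cycle drawn inside the face bounded by C) the newly created faces
-- are bounded by  v_i (along C) v_{i+1} w_{i+1} x_i w_i.
altan : List Hex → ℕ → ℕ → Edges → List AVert → AltanResult
altan K p s E C = record
  { newEdges = concatMap edgesAt (upTo d)
  ; newCycle = concatMap (λ i → w i ∷ x i ∷ []) (upTo d)
  ; newFaces = map faceAt (upTo d)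
  }
  where
  ds : List ℕ                -- positions on C of the degree-2 vertices
  ds = filterᵇ (λ j → any (λ v → deg K E v ≡ᵇ 2) (take 1 (drop j C))) (upTo (length C))
  d : ℕ
  d = length ds
  w x : ℕ → AVert
  w i = inj₂ (p , s , i , false)
  x i = inj₂ (p , s , i , true)
  nxt : ℕ → ℕ
  nxt i = if suc i ≡ᵇ d then 0 else suc i
  -- the path along C from position c to position n (cyclically), inclusive
  seg : ℕ → ℕ → List AVert
  seg c n = if c <ᵇ n then take (n ∸ c N.+ 1) (drop c C) else drop c C ++ take (n N.+ 1) C
  edgesAt : ℕ → Edges
  edgesAt i = map (λ v → (v , w i)) (take 1 (drop (at ds i) C))
              ++ (w i , x i) ∷ (x i , w (nxt i)) ∷ []
  faceAt : ℕ → List AVert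
  faceAt i = seg (at ds i) (at ds (nxt i)) ++ w (nxt i) ∷ x i ∷ w i ∷ []

State : Set
State = Edges × List (List AVert)

runPos : List Hex → ℕ → ℕ → ℕ → State → List AVert → State
runPos K p zero    s st      C = st
runPos K p (suc n) s (E , F) C =
  runPos K p n (suc s) (E ++ AltanResult.newEdges r , F ++ AltanResult.newFaces r)
         (AltanResult.newCycle r)
  where r = altan K p s E C

runAll : List Hex → ℕ → List ℕ → List (List AVert) → State → State
runAll K p (n ∷ ns) (C ∷ Cs) st = runAll K (suc p) ns Cs (runPos K p n 0 st C)
runAll K p _        _        st = st

-- Bounded faces of A^n(G(K); C₁,…,C_k) in its natural plane embedding:
-- the hexagons of K together with the newly created faces.
altanFaces : (K : List Hex) (Cs : List (List LVertex)) → Vec ℕ (length Cs) → List (List AVert)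
altanFaces K Cs ns =
  proj₂ (runAll K 0 (toList ns) (map (map inj₁) Cs)
                ([] , map (λ h → map inj₁ (corners h)) K))

IsHexagonFace : List AVert → Set
IsHexagonFace f = length f ≡ 6

-- Only the first altan operation matters. It acts at the first position with a nonzero count, on a perimeter C
-- of G(K) itself, and its new faces are bounded by the stretch of C between consecutive degree-2 vertices
-- together with three new vertices. So they are all hexagons only if C has no degree-2 vertex, or if degree-2
-- vertices and degree-3 vertices alternate along C.
-- Along a perimeter a vertex has degree 2 exactly when K contains the hexagon between its two perimeter edges,
-- and two consecutive turns go the same way exactly when they turn around the same hexagon. Without degree-2
-- vertices the walk therefore keeps turning around one hexagon outside K whose six neighbours all lie in K: a
-- single-hexagon corona hole, excluded by non-degeneracy. With alternating degrees the walk zigzags, advancing by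
-- a fixed nonzero vector every two steps, so it can never close up.

module Submission where

open import Defs
open import Data.Bool using (Bool; true; false; not; _∧_; _∨_; if_then_else_; T?)
open import Data.Bool.Properties using (T-≡; not-¬; not-involutive; ∨-identityʳ)
open import Data.Bool.ListAction using (any)
open import Data.Nat using (ℕ; zero; suc; _+_; _∸_; _≤_; _<_; z≤n; s≤s; z<s; _<ᵇ_; _≡ᵇ_; NonZero)
open import Data.Nat.Properties
open import Data.Nat.DivMod using (_%_; _/_; m%n<n; m<n⇒m%n≡m; n%n≡0; [m+n]%n≡m%n; [m+kn]%n≡m%n; m≡m%n+[m/n]*n; m≤n⇒[n∸m]%m≡n%m)
open import Data.Integer using (0ℤ; 1ℤ; +_) renaming (_+_ to _+ℤ_; _-_ to _-ℤ_; _*_ to _*ℤ_)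
import Data.Integer.Properties as ℤ
open import Data.Integer.Tactic.RingSolver using (solve-∀)
open import Data.Product using (_×_; _,_; proj₁; proj₂; ∃-syntax)
open import Data.Product.Properties using (,-injectiveˡ; ,-injectiveʳ)
open import Data.Sum using (_⊎_; inj₁; inj₂)
open import Data.List using (List; []; _∷_; _++_; _∷ʳ_; length; map; take; drop; zip; filterᵇ; upTo; concatMap)
open import Data.List.Properties using (length-map; length-++; length-take; length-drop; upTo-∷ʳ; filter-++; filter-accept)
open import Data.List.Relation.Unary.All using (All; []; _∷_; universal)
import Data.List.Relation.Unary.All as All
open import Data.List.Relation.Unary.All.Properties using (concat⁺; map⁺; map⁻; ++⁻ˡ; ++⁻ʳ)
import Data.List.Relation.Unary.AllPairs as AllPairs
open import Data.List.Relation.Unary.Any using (here; there)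
open import Data.List.Relation.Unary.Unique.Propositional using (Unique)
open import Data.List.Membership.Propositional using (_∈_; _∉_; find)
open import Data.List.Membership.Propositional.Properties using (∈-upTo⁺)
open import Data.List.Membership.DecPropositional _≟H_ using (_∈?_)
open import Data.Vec using (Vec; replicate; toList; []; _∷_)
open import Data.Unit using (tt)
open import Data.Empty using (⊥; ⊥-elim)
open import Function using (Equivalence; _∘_; case_of_)
open import Relation.Binary.PropositionalEquality
open import Relation.Nullary using (¬_; yes; no)
open import Relation.Nullary.Decidable using (toWitness; dec-true; dec-false)

bit : Bool → ℕ
bit true  = 1
bit false = 0

∈⇒∈ᵇH : ∀ {h} L → h ∈ L → h ∈ᵇH L ≡ true
∈⇒∈ᵇH {h} (h′ ∷ L) h∈ with h ≟H h′ | h∈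
... | yes _   | _          = refl
... | no h≢h′ | here h≡h′  = ⊥-elim (h≢h′ h≡h′)
... | no _    | there h∈L  = ∈⇒∈ᵇH L h∈L

∈ᵇH⇒∈ : ∀ {h} L → h ∈ᵇH L ≡ true → h ∈ L
∈ᵇH⇒∈ {h} (h′ ∷ L) eq with h ≟H h′
... | yes h≡h′ = here h≡h′
... | no _     = there (∈ᵇH⇒∈ L eq)

∉⇒∈ᵇH : ∀ {h} L → h ∉ L → h ∈ᵇH L ≡ false
∉⇒∈ᵇH {h} L h∉ with h ∈ᵇH L in eq
... | true  = ⊥-elim (h∉ (∈ᵇH⇒∈ L eq))
... | false = refl

length-filterᵇ-∷ : ∀ {A : Set} (p : A → Bool) x xs →
                   length (filterᵇ p (x ∷ xs)) ≡ bit (p x) + length (filterᵇ p xs)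
length-filterᵇ-∷ p x xs with p x
... | true  = refl
... | false = refl

length-filterᵇ-3 : ∀ {A : Set} (p : A → Bool) x y z →
                   length (filterᵇ p (x ∷ y ∷ z ∷ [])) ≡ bit (p x) + (bit (p y) + bit (p z))
length-filterᵇ-3 p x y z
  rewrite length-filterᵇ-∷ p x (y ∷ z ∷ []) | length-filterᵇ-∷ p y (z ∷ [])
        | length-filterᵇ-∷ p z [] | +-identityʳ (bit (p z)) = refl

-- Local geometry of the hexagonal lattice

x≢x+1 : ∀ x → x ≢ x +ℤ 1ℤ
x≢x+1 x eq = ℤ.i≢suc[i] (trans eq (ℤ.+-comm x 1ℤ))

x-1+1≡x : ∀ x → x -ℤ 1ℤ +ℤ 1ℤ ≡ x
x-1+1≡x = solve-∀

x+1-1≡x : ∀ x → x +ℤ 1ℤ -ℤ 1ℤ ≡ x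
x+1-1≡x = solve-∀

x≡x+1-1 : ∀ x → x ≡ x +ℤ 1ℤ -ℤ 1ℤ
x≡x+1-1 x = sym (x+1-1≡x x)

x≡x+0 : ∀ x → x ≡ x +ℤ 0ℤ
x≡x+0 x = sym (ℤ.+-identityʳ x)

x+1+1-x≡2 : ∀ x → x +ℤ 1ℤ +ℤ 1ℤ -ℤ x ≡ + 2
x+1+1-x≡2 = solve-∀

x≢x+1+1 : ∀ x → x ≢ x +ℤ 1ℤ +ℤ 1ℤ
x≢x+1+1 x eq with trans (sym (ℤ.+-inverseʳ x)) (trans (cong (_-ℤ x) eq) (x+1+1-x≡2 x))
... | ()

data Dir : Set where
  d₀ d₁ d₂ : Dir

side : LVertex → Bool
side (_ , _ , s) = s

-- move v k is the k-th entry of nbrs v.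
move : LVertex → Dir → LVertex
move (a , b , false) d₀ = (a , b , true)
move (a , b , false) d₁ = (a -ℤ 1ℤ , b , true)
move (a , b , false) d₂ = (a , b -ℤ 1ℤ , true)
move (a , b , true)  d₀ = (a , b , false)
move (a , b , true)  d₁ = (a +ℤ 1ℤ , b , false)
move (a , b , true)  d₂ = (a , b +ℤ 1ℤ , false)

-- The hexagon at v that does not contain the edge from v to move v k.
opposite : LVertex → Dir → Hex
opposite (a , b , false) d₀ = (a , b)
opposite (a , b , false) d₁ = (a +ℤ 1ℤ , b)
opposite (a , b , false) d₂ = (a , b +ℤ 1ℤ)
opposite (a , b , true)  d₀ = (a +ℤ 1ℤ , b +ℤ 1ℤ)
opposite (a , b , true)  d₁ = (a , b +ℤ 1ℤ)
opposite (a , b , true)  d₂ = (a +ℤ 1ℤ , b)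

other₁ other₂ : Dir → Dir
other₁ d₀ = d₁
other₁ d₁ = d₀
other₁ d₂ = d₀
other₂ d₀ = d₂
other₂ d₁ = d₂
other₂ d₂ = d₁

third : Dir → Dir → Dir
third d₀ d₁ = d₂
third d₀ d₂ = d₁
third d₁ d₀ = d₂
third d₁ d₂ = d₀
third d₂ d₀ = d₁
third d₂ d₁ = d₀
third i  _  = i

other₁≢ : ∀ k → other₁ k ≢ k
other₁≢ d₀ ()
other₁≢ d₁ ()
other₁≢ d₂ ()

other₂≢ : ∀ k → other₂ k ≢ k
other₂≢ d₀ ()
other₂≢ d₁ ()
other₂≢ d₂ ()

third-comm : ∀ i o → third i o ≡ third o i
third-comm d₀ d₀ = refl
third-comm d₀ d₁ = refl
third-comm d₀ d₂ = refl
third-comm d₁ d₀ = refl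
third-comm d₁ d₁ = refl
third-comm d₁ d₂ = refl
third-comm d₂ d₀ = refl
third-comm d₂ d₁ = refl
third-comm d₂ d₂ = refl

third-other₁ : ∀ k → third k (other₁ k) ≡ other₂ k
third-other₁ d₀ = refl
third-other₁ d₁ = refl
third-other₁ d₂ = refl

third-other₂ : ∀ k → third k (other₂ k) ≡ other₁ k
third-other₂ d₀ = refl
third-other₂ d₁ = refl
third-other₂ d₂ = refl

third≢ˡ : ∀ i o → i ≢ o → third i o ≢ i
third≢ˡ d₀ d₀ i≢o = ⊥-elim (i≢o refl)
third≢ˡ d₁ d₁ i≢o = ⊥-elim (i≢o refl)
third≢ˡ d₂ d₂ i≢o = ⊥-elim (i≢o refl)
third≢ˡ d₀ d₁ _ ()
third≢ˡ d₀ d₂ _ ()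
third≢ˡ d₁ d₀ _ ()
third≢ˡ d₁ d₂ _ ()
third≢ˡ d₂ d₀ _ ()
third≢ˡ d₂ d₁ _ ()

third≢ʳ : ∀ i o → i ≢ o → third i o ≢ o
third≢ʳ i o i≢o rewrite third-comm i o = third≢ˡ o i (i≢o ∘ sym)

third-cases : ∀ i o k → i ≢ o → k ≢ o → k ≡ i ⊎ k ≡ third i o
third-cases d₀ d₁ d₀ _ _ = inj₁ refl
third-cases d₀ d₁ d₂ _ _ = inj₂ refl
third-cases d₀ d₂ d₀ _ _ = inj₁ refl
third-cases d₀ d₂ d₁ _ _ = inj₂ refl
third-cases d₁ d₀ d₁ _ _ = inj₁ refl
third-cases d₁ d₀ d₂ _ _ = inj₂ refl
third-cases d₁ d₂ d₀ _ _ = inj₂ refl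
third-cases d₁ d₂ d₁ _ _ = inj₁ refl
third-cases d₂ d₀ d₁ _ _ = inj₂ refl
third-cases d₂ d₀ d₂ _ _ = inj₁ refl
third-cases d₂ d₁ d₀ _ _ = inj₂ refl
third-cases d₂ d₁ d₂ _ _ = inj₁ refl
third-cases d₀ d₀ _  i≢o _ = ⊥-elim (i≢o refl)
third-cases d₁ d₁ _  i≢o _ = ⊥-elim (i≢o refl)
third-cases d₂ d₂ _  i≢o _ = ⊥-elim (i≢o refl)
third-cases d₀ d₁ d₁ _ k≢o = ⊥-elim (k≢o refl)
third-cases d₀ d₂ d₂ _ k≢o = ⊥-elim (k≢o refl)
third-cases d₁ d₀ d₀ _ k≢o = ⊥-elim (k≢o refl)
third-cases d₁ d₂ d₂ _ k≢o = ⊥-elim (k≢o refl)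
third-cases d₂ d₀ d₀ _ k≢o = ⊥-elim (k≢o refl)
third-cases d₂ d₁ d₁ _ k≢o = ⊥-elim (k≢o refl)

side-move : ∀ v k → side (move v k) ≡ not (side v)
side-move (a , b , false) d₀ = refl
side-move (a , b , false) d₁ = refl
side-move (a , b , false) d₂ = refl
side-move (a , b , true)  d₀ = refl
side-move (a , b , true)  d₁ = refl
side-move (a , b , true)  d₂ = refl

move-involutive : ∀ v k → move (move v k) k ≡ v
move-involutive (a , b , false) d₀ = refl
move-involutive (a , b , false) d₁ = cong (λ x → (x , b , false)) (x-1+1≡x a)
move-involutive (a , b , false) d₂ = cong (λ y → (a , y , false)) (x-1+1≡x b)
move-involutive (a , b , true)  d₀ = refl
move-involutive (a , b , true)  d₁ = cong (λ x → (x , b , true)) (x+1-1≡x a)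
move-involutive (a , b , true)  d₂ = cong (λ y → (a , y , true)) (x+1-1≡x b)

nbrs≡moves : ∀ v → nbrs v ≡ move v d₀ ∷ move v d₁ ∷ move v d₂ ∷ []
nbrs≡moves (a , b , false) = refl
nbrs≡moves (a , b , true)  = refl

∈nbrs⇒move : ∀ {u v} → v ∈ nbrs u → ∃[ k ] v ≡ move u k
∈nbrs⇒move {u} v∈ rewrite nbrs≡moves u with v∈
... | here eq                 = d₀ , eq
... | there (here eq)         = d₁ , eq
... | there (there (here eq)) = d₂ , eq

opposite-∈-hexesOf : ∀ v k → opposite v k ∈ hexesOf v
opposite-∈-hexesOf (a , b , false) d₀ = here refl
opposite-∈-hexesOf (a , b , false) d₁ = there (here refl)
opposite-∈-hexesOf (a , b , false) d₂ = there (there (here refl))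
opposite-∈-hexesOf (a , b , true)  d₀ = there (there (here refl))
opposite-∈-hexesOf (a , b , true)  d₁ = there (here refl)
opposite-∈-hexesOf (a , b , true)  d₂ = here refl

-- The hexagons on the edge k, named from its other endpoint.
opposite-move : ∀ v {k m} → m ≢ k → opposite v m ≡ opposite (move v k) (third k m)
opposite-move (a , b , false) {d₀} {d₀} m≢k = ⊥-elim (m≢k refl)
opposite-move (a , b , false) {d₀} {d₁} _ = refl
opposite-move (a , b , false) {d₀} {d₂} _ = refl
opposite-move (a , b , false) {d₁} {d₀} _ = cong (_, b) (sym (x-1+1≡x a))
opposite-move (a , b , false) {d₁} {d₁} m≢k = ⊥-elim (m≢k refl)
opposite-move (a , b , false) {d₁} {d₂} _ = cong (_, b +ℤ 1ℤ) (sym (x-1+1≡x a))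
opposite-move (a , b , false) {d₂} {d₀} _ = cong (a ,_) (sym (x-1+1≡x b))
opposite-move (a , b , false) {d₂} {d₁} _ = cong (a +ℤ 1ℤ ,_) (sym (x-1+1≡x b))
opposite-move (a , b , false) {d₂} {d₂} m≢k = ⊥-elim (m≢k refl)
opposite-move (a , b , true)  {d₀} {d₀} m≢k = ⊥-elim (m≢k refl)
opposite-move (a , b , true)  {d₀} {d₁} _ = refl
opposite-move (a , b , true)  {d₀} {d₂} _ = refl
opposite-move (a , b , true)  {d₁} {d₀} _ = refl
opposite-move (a , b , true)  {d₁} {d₁} m≢k = ⊥-elim (m≢k refl)
opposite-move (a , b , true)  {d₁} {d₂} _ = refl
opposite-move (a , b , true)  {d₂} {d₀} _ = refl
opposite-move (a , b , true)  {d₂} {d₁} _ = refl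
opposite-move (a , b , true)  {d₂} {d₂} m≢k = ⊥-elim (m≢k refl)

∉-3 : ∀ {x y z w : Hex} → x ≢ y → x ≢ z → x ≢ w → x ∉ y ∷ z ∷ w ∷ []
∉-3 x≢y _ _ (here x≡y) = x≢y x≡y
∉-3 _ x≢z _ (there (here x≡z)) = x≢z x≡z
∉-3 _ _ x≢w (there (there (here x≡w))) = x≢w x≡w

opposite-∉-hexesOf-move : ∀ v k → opposite v k ∉ hexesOf (move v k)
opposite-∉-hexesOf-move (a , b , false) d₀ =
  ∉-3 (x≢x+1 a ∘ ,-injectiveˡ) (x≢x+1 b ∘ ,-injectiveʳ) (x≢x+1 a ∘ ,-injectiveˡ)
opposite-∉-hexesOf-move (a , b , false) d₁ =
  ∉-3 (x+1≢x-1+1 ∘ ,-injectiveˡ) (x≢x+1 b ∘ ,-injectiveʳ) (x≢x+1 b ∘ ,-injectiveʳ)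
  where
  x+1≢x-1+1 : a +ℤ 1ℤ ≢ a -ℤ 1ℤ +ℤ 1ℤ
  x+1≢x-1+1 eq = x≢x+1 a (sym (trans eq (x-1+1≡x a)))
opposite-∉-hexesOf-move (a , b , false) d₂ =
  ∉-3 (x≢x+1 a ∘ ,-injectiveˡ) (y+1≢y-1+1 ∘ ,-injectiveʳ) (x≢x+1 a ∘ ,-injectiveˡ)
  where
  y+1≢y-1+1 : b +ℤ 1ℤ ≢ b -ℤ 1ℤ +ℤ 1ℤ
  y+1≢y-1+1 eq = x≢x+1 b (sym (trans eq (x-1+1≡x b)))
opposite-∉-hexesOf-move (a , b , true) d₀ =
  ∉-3 (x≢x+1 a ∘ sym ∘ ,-injectiveˡ) (x≢x+1 b ∘ sym ∘ ,-injectiveʳ) (x≢x+1 a ∘ sym ∘ ,-injectiveˡ)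
opposite-∉-hexesOf-move (a , b , true) d₁ =
  ∉-3 (x≢x+1 a ∘ ,-injectiveˡ) (x≢x+1+1 a ∘ ,-injectiveˡ) (x≢x+1 a ∘ ,-injectiveˡ)
opposite-∉-hexesOf-move (a , b , true) d₂ =
  ∉-3 (x≢x+1 a ∘ sym ∘ ,-injectiveˡ) (x≢x+1 b ∘ ,-injectiveʳ) (x≢x+1 a ∘ sym ∘ ,-injectiveˡ)

sumDir : (Dir → ℕ) → ℕ
sumDir g = g d₀ + (g d₁ + g d₂)

sumDir-cong : ∀ {g h} → (∀ k → g k ≡ h k) → sumDir g ≡ sumDir h
sumDir-cong g≗h = cong₂ _+_ (g≗h d₀) (cong₂ _+_ (g≗h d₁) (g≗h d₂))

sumDir-drop : ∀ g k → g k ≡ 0 → sumDir g ≡ g (other₁ k) + g (other₂ k)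
sumDir-drop g d₀ g₀≡0 rewrite g₀≡0 = refl
sumDir-drop g d₁ g₁≡0 rewrite g₁≡0 = refl
sumDir-drop g d₂ g₂≡0 rewrite g₂≡0 = cong (λ n → g d₀ + n) (+-identityʳ (g d₁))

-- The edge k lies on the hexagons opposite the two other directions; edgeCount counts those satisfying f.
edgeCount : (Dir → Bool) → Dir → ℕ
edgeCount f k = bit (f (other₁ k)) + bit (f (other₂ k))

kCount≡sumDir : ∀ K v w →
  kCount K v w ≡ sumDir (λ m → bit ((opposite v m ∈ᵇH hexesOf w) ∧ (opposite v m ∈ᵇH K)))
kCount≡sumDir K (a , b , false) w = length-filterᵇ-3 (λ h → (h ∈ᵇH hexesOf w) ∧ (h ∈ᵇH K)) _ _ _
kCount≡sumDir K v@(a , b , true)  w = begin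
  kCount K v w                                     ≡⟨ length-filterᵇ-3 p _ _ _ ⟩
  bit (p (opposite v d₂)) + (bit (p (opposite v d₁)) + bit (p (opposite v d₀)))
    ≡⟨ +-comm (bit (p (opposite v d₂))) _ ⟩
  (bit (p (opposite v d₁)) + bit (p (opposite v d₀))) + bit (p (opposite v d₂))
    ≡⟨ cong (_+ bit (p (opposite v d₂))) (+-comm (bit (p (opposite v d₁))) _) ⟩
  (bit (p (opposite v d₀)) + bit (p (opposite v d₁))) + bit (p (opposite v d₂))
    ≡⟨ +-assoc (bit (p (opposite v d₀))) _ _ ⟩
  sumDir (λ m → bit (p (opposite v m)))           ∎
  where
  open ≡-Reasoning
  p : Hex → Bool
  p h = (h ∈ᵇH hexesOf w) ∧ (h ∈ᵇH K)

kCount-move : ∀ K v k → kCount K v (move v k) ≡ edgeCount (λ m → opposite v m ∈ᵇH K) k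
kCount-move K v k = begin
  kCount K v (move v k)                   ≡⟨ kCount≡sumDir K v (move v k) ⟩
  sumDir g
    ≡⟨ sumDir-drop g k (on-edge-if _ (∉⇒∈ᵇH _ (opposite-∉-hexesOf-move v k))) ⟩
  g (other₁ k) + g (other₂ k)             ≡⟨ cong₂ _+_ (on-edge (other₁≢ k)) (on-edge (other₂≢ k)) ⟩
  edgeCount (λ m → opposite v m ∈ᵇH K) k  ∎
  where
  open ≡-Reasoning
  g : Dir → ℕ
  g m = bit ((opposite v m ∈ᵇH hexesOf (move v k)) ∧ (opposite v m ∈ᵇH K))
  on-edge-if : ∀ m {b} → opposite v m ∈ᵇH hexesOf (move v k) ≡ b → g m ≡ bit (b ∧ (opposite v m ∈ᵇH K))
  on-edge-if m eq = cong (λ b → bit (b ∧ (opposite v m ∈ᵇH K))) eq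
  on-edge : ∀ {m} → m ≢ k → g m ≡ bit (opposite v m ∈ᵇH K)
  on-edge {m} m≢k = on-edge-if m (∈⇒∈ᵇH _ (subst (_∈ hexesOf (move v k)) (sym (opposite-move v m≢k))
                                              (opposite-∈-hexesOf (move v k) (third k m))))

edgeCount-move : ∀ f v k → edgeCount (f ∘ opposite (move v k)) k ≡ edgeCount (f ∘ opposite v) k
edgeCount-move f v k = begin
  bit (f (opposite (move v k) (other₁ k))) + bit (f (opposite (move v k) (other₂ k)))
    ≡⟨ +-comm (bit (f (opposite (move v k) (other₁ k)))) _ ⟩
  bit (f (opposite (move v k) (other₂ k))) + bit (f (opposite (move v k) (other₁ k)))
    ≡⟨ cong₂ (λ x y → bit (f x) + bit (f y)) (seen-from-v (other₁≢ k) (third-other₁ k))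
                                             (seen-from-v (other₂≢ k) (third-other₂ k)) ⟩
  bit (f (opposite v (other₁ k))) + bit (f (opposite v (other₂ k)))  ∎
  where
  open ≡-Reasoning
  seen-from-v : ∀ {m m′} → m ≢ k → third k m ≡ m′ → opposite (move v k) m′ ≡ opposite v m
  seen-from-v m≢k refl = sym (opposite-move v m≢k)

edgeCount-corner : ∀ f i o → i ≢ o → edgeCount f i ≡ bit (f (third i o)) + bit (f o)
edgeCount-corner f d₀ d₀ i≢o = ⊥-elim (i≢o refl)
edgeCount-corner f d₁ d₁ i≢o = ⊥-elim (i≢o refl)
edgeCount-corner f d₂ d₂ i≢o = ⊥-elim (i≢o refl)
edgeCount-corner f d₀ d₁ _ = +-comm (bit (f d₁)) _
edgeCount-corner f d₀ d₂ _ = refl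
edgeCount-corner f d₁ d₀ _ = +-comm (bit (f d₀)) _
edgeCount-corner f d₁ d₂ _ = refl
edgeCount-corner f d₂ d₀ _ = +-comm (bit (f d₀)) _
edgeCount-corner f d₂ d₁ _ = refl

degreeOf : (Dir → Bool) → ℕ
degreeOf f = sumDir (λ k → bit (0 <ᵇ edgeCount f k))

baseDeg-opposite : ∀ K v → baseDeg K v ≡ degreeOf (λ m → opposite v m ∈ᵇH K)
baseDeg-opposite K v = begin
  baseDeg K v                                          ≡⟨ cong (length ∘ filterᵇ p) (nbrs≡moves v) ⟩
  length (filterᵇ p (move v d₀ ∷ move v d₁ ∷ move v d₂ ∷ [])) ≡⟨ length-filterᵇ-3 p _ _ _ ⟩
  sumDir (λ k → bit (p (move v k)))
    ≡⟨ sumDir-cong (λ k → cong (λ n → bit (0 <ᵇ n)) (kCount-move K v k)) ⟩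
  degreeOf (λ m → opposite v m ∈ᵇH K)                  ∎
  where
  open ≡-Reasoning
  p : LVertex → Bool
  p w = 0 <ᵇ kCount K v w

-- The hexagons at a vertex of a perimeter: a is the one between the two perimeter edges, b and c the others.
data Corner : Bool → Bool → Bool → Set where
  convex : Corner true false false
  reflex : Corner false true true

corner : ∀ {a b c} → bit a + bit b ≡ 1 → bit a + bit c ≡ 1 → Corner a b c
corner {true}  {false} {false} _ _ = convex
corner {false} {true}  {true}  _ _ = reflex
corner {true}  {true}  {_}     () _
corner {true}  {false} {true}  _ ()
corner {false} {false} {_}     () _
corner {false} {true}  {false} _ ()

corner-reflex : ∀ {a b c} → Corner a b c → a ≡ false → b ≡ true × c ≡ true
corner-reflex reflex _ = refl , refl

degreeOf-corner : ∀ f i o → i ≢ o → Corner (f (third i o)) (f o) (f i) → (degreeOf f ≡ᵇ 2) ≡ f (third i o)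
degreeOf-corner f d₀ d₀ i≢o _ = ⊥-elim (i≢o refl)
degreeOf-corner f d₁ d₁ i≢o _ = ⊥-elim (i≢o refl)
degreeOf-corner f d₂ d₂ i≢o _ = ⊥-elim (i≢o refl)
degreeOf-corner f d₀ d₁ _ c with f d₀ | f d₁ | f d₂ | c
... | _ | _ | _ | convex = refl
... | _ | _ | _ | reflex = refl
degreeOf-corner f d₀ d₂ _ c with f d₀ | f d₁ | f d₂ | c
... | _ | _ | _ | convex = refl
... | _ | _ | _ | reflex = refl
degreeOf-corner f d₁ d₀ _ c with f d₀ | f d₁ | f d₂ | c
... | _ | _ | _ | convex = refl
... | _ | _ | _ | reflex = refl
degreeOf-corner f d₁ d₂ _ c with f d₀ | f d₁ | f d₂ | c
... | _ | _ | _ | convex = refl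
... | _ | _ | _ | reflex = refl
degreeOf-corner f d₂ d₀ _ c with f d₀ | f d₁ | f d₂ | c
... | _ | _ | _ | convex = refl
... | _ | _ | _ | reflex = refl
degreeOf-corner f d₂ d₁ _ c with f d₀ | f d₁ | f d₂ | c
... | _ | _ | _ | convex = refl
... | _ | _ | _ | reflex = refl

offset : Bool → Dir → Dir → Hex
offset false d₀ d₁ = (1ℤ , 0ℤ)
offset false d₀ d₂ = (0ℤ , 1ℤ)
offset false d₁ d₀ = (-1ℤ , 0ℤ)
offset false d₁ d₂ = (-1ℤ , 1ℤ)
offset false d₂ d₀ = (0ℤ , -1ℤ)
offset false d₂ d₁ = (1ℤ , -1ℤ)
offset true  d₀ d₁ = (-1ℤ , 0ℤ)
offset true  d₀ d₂ = (0ℤ , -1ℤ)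
offset true  d₁ d₀ = (1ℤ , 0ℤ)
offset true  d₁ d₂ = (1ℤ , -1ℤ)
offset true  d₂ d₀ = (0ℤ , 1ℤ)
offset true  d₂ d₁ = (-1ℤ , 1ℤ)
offset _     _  _  = (0ℤ , 0ℤ)

opposite-offset : ∀ v t m → m ≢ t → opposite v m ≡ opposite v t ⊕ offset (side v) t m
opposite-offset (a , b , false) d₀ d₀ m≢t = ⊥-elim (m≢t refl)
opposite-offset (a , b , false) d₀ d₁ _ = cong (a +ℤ 1ℤ ,_) (x≡x+0 b)
opposite-offset (a , b , false) d₀ d₂ _ = cong (_, b +ℤ 1ℤ) (x≡x+0 a)
opposite-offset (a , b , false) d₁ d₀ _ = cong₂ _,_ (x≡x+1-1 a) (x≡x+0 b)
opposite-offset (a , b , false) d₁ d₁ m≢t = ⊥-elim (m≢t refl)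
opposite-offset (a , b , false) d₁ d₂ _ = cong (_, b +ℤ 1ℤ) (x≡x+1-1 a)
opposite-offset (a , b , false) d₂ d₀ _ = cong₂ _,_ (x≡x+0 a) (x≡x+1-1 b)
opposite-offset (a , b , false) d₂ d₁ _ = cong (a +ℤ 1ℤ ,_) (x≡x+1-1 b)
opposite-offset (a , b , false) d₂ d₂ m≢t = ⊥-elim (m≢t refl)
opposite-offset (a , b , true)  d₀ d₀ m≢t = ⊥-elim (m≢t refl)
opposite-offset (a , b , true)  d₀ d₁ _ = cong₂ _,_ (x≡x+1-1 a) (x≡x+0 (b +ℤ 1ℤ))
opposite-offset (a , b , true)  d₀ d₂ _ = cong₂ _,_ (x≡x+0 (a +ℤ 1ℤ)) (x≡x+1-1 b)
opposite-offset (a , b , true)  d₁ d₀ _ = cong (a +ℤ 1ℤ ,_) (x≡x+0 (b +ℤ 1ℤ))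
opposite-offset (a , b , true)  d₁ d₁ m≢t = ⊥-elim (m≢t refl)
opposite-offset (a , b , true)  d₁ d₂ _ = cong (a +ℤ 1ℤ ,_) (x≡x+1-1 b)
opposite-offset (a , b , true)  d₂ d₀ _ = cong (_, b +ℤ 1ℤ) (x≡x+0 (a +ℤ 1ℤ))
opposite-offset (a , b , true)  d₂ d₁ _ = cong (_, b +ℤ 1ℤ) (x≡x+1-1 a)
opposite-offset (a , b , true)  d₂ d₂ m≢t = ⊥-elim (m≢t refl)

cell : LVertex → Hex
cell (a , b , _) = (a , b)

cell-move² : ∀ v p q → cell (move (move v p) q) ≡ cell v ⊕ offset (side v) p q
cell-move² (a , b , false) d₀ d₀ = cong₂ _,_ (x≡x+0 a) (x≡x+0 b)
cell-move² (a , b , false) d₀ d₁ = cong₂ _,_ refl (x≡x+0 b)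
cell-move² (a , b , false) d₀ d₂ = cong₂ _,_ (x≡x+0 a) refl
cell-move² (a , b , false) d₁ d₀ = cong₂ _,_ refl (x≡x+0 b)
cell-move² (a , b , false) d₁ d₁ = cong₂ _,_ (trans (x-1+1≡x a) (x≡x+0 a)) (x≡x+0 b)
cell-move² (a , b , false) d₁ d₂ = refl
cell-move² (a , b , false) d₂ d₀ = cong₂ _,_ (x≡x+0 a) refl
cell-move² (a , b , false) d₂ d₁ = refl
cell-move² (a , b , false) d₂ d₂ = cong₂ _,_ (x≡x+0 a) (trans (x-1+1≡x b) (x≡x+0 b))
cell-move² (a , b , true ) d₀ d₀ = cong₂ _,_ (x≡x+0 a) (x≡x+0 b)
cell-move² (a , b , true ) d₀ d₁ = cong₂ _,_ refl (x≡x+0 b)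
cell-move² (a , b , true ) d₀ d₂ = cong₂ _,_ (x≡x+0 a) refl
cell-move² (a , b , true ) d₁ d₀ = cong₂ _,_ refl (x≡x+0 b)
cell-move² (a , b , true ) d₁ d₁ = cong₂ _,_ (trans (x+1-1≡x a) (x≡x+0 a)) (x≡x+0 b)
cell-move² (a , b , true ) d₁ d₂ = refl
cell-move² (a , b , true ) d₂ d₀ = cong₂ _,_ (x≡x+0 a) refl
cell-move² (a , b , true ) d₂ d₁ = refl
cell-move² (a , b , true ) d₂ d₂ = cong₂ _,_ (x≡x+0 a) (trans (x+1-1≡x b) (x≡x+0 b))

offset≢0 : ∀ s p q → p ≢ q → offset s p q ≢ (0ℤ , 0ℤ)
offset≢0 _     d₀ d₀ p≢q _ = p≢q refl
offset≢0 _     d₁ d₁ p≢q _ = p≢q refl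
offset≢0 _     d₂ d₂ p≢q _ = p≢q refl
offset≢0 false d₀ d₁ _ ()
offset≢0 false d₀ d₂ _ ()
offset≢0 false d₁ d₀ _ ()
offset≢0 false d₁ d₂ _ ()
offset≢0 false d₂ d₀ _ ()
offset≢0 false d₂ d₁ _ ()
offset≢0 true  d₀ d₁ _ ()
offset≢0 true  d₀ d₂ _ ()
offset≢0 true  d₁ d₀ _ ()
offset≢0 true  d₁ d₂ _ ()
offset≢0 true  d₂ d₀ _ ()
offset≢0 true  d₂ d₁ _ ()

infixl 7 _·_
_·_ : ℕ → Hex → Hex
n · (x , y) = (+ n *ℤ x , + n *ℤ y)

⊕-·-suc : ∀ h n d → (h ⊕ (n · d)) ⊕ d ≡ h ⊕ (suc n · d)
⊕-·-suc (a , b) n (x , y) = cong₂ _,_ (distrib a (+ n) x) (distrib b (+ n) y)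
  where
  distrib : ∀ a k x → a +ℤ k *ℤ x +ℤ x ≡ a +ℤ (1ℤ +ℤ k) *ℤ x
  distrib = solve-∀

⊕-·-suc≢ : ∀ h m d → d ≢ (0ℤ , 0ℤ) → h ⊕ (suc m · d) ≢ h
⊕-·-suc≢ (a , b) m (x , y) d≢0 eq =
  d≢0 (cong₂ _,_ (factor≡0 (,-injectiveˡ eq)) (factor≡0 (,-injectiveʳ eq)))
  where
  a+z≡a⇒z≡0 : ∀ {a z} → a +ℤ z ≡ a → z ≡ 0ℤ
  a+z≡a⇒z≡0 {a} {z} eq = trans (z≡a+z-a a z) (trans (cong (_-ℤ a) eq) (ℤ.+-inverseʳ a))
    where
    z≡a+z-a : ∀ a z → z ≡ a +ℤ z -ℤ a
    z≡a+z-a = solve-∀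
  factor≡0 : ∀ {a z} → a +ℤ + suc m *ℤ z ≡ a → z ≡ 0ℤ
  factor≡0 eq with ℤ.i*j≡0⇒i≡0∨j≡0 (+ suc m) (a+z≡a⇒z≡0 eq)
  ... | inj₁ ()
  ... | inj₂ z≡0 = z≡0

-- Walks along a perimeter

rotationDirs : Dir → Dir → ℕ → Dir
rotationDirs p q zero          = p
rotationDirs p q (suc zero)    = q
rotationDirs p q (suc (suc x)) = third (rotationDirs p q x) (rotationDirs p q (suc x))

alternate : Bool → ℕ → Bool
alternate s zero    = s
alternate s (suc x) = not (alternate s x)

-- Offsets from the turn hexagon of the two other hexagons at a vertex entered along i and left along o.
ringStep : Bool → Dir → Dir → List Hex
ringStep s i o = offset s (third i o) i ∷ offset s (third i o) o ∷ []

ringOffsets : Bool → Dir → Dir → List Hex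
ringOffsets s p q = concatMap (λ x → ringStep (alternate s x) (rotationDirs p q x) (rotationDirs p q (suc x))) (upTo 6)

-- Six steps of turning the same way go once around a hexagon and meet all its neighbours.
ringOffsets-complete : ∀ s p q → p ≢ q → All (_∈ ringOffsets s p q) dirs
ringOffsets-complete false d₀ d₁ _ = toWitness {a? = All.all? (_∈? ringOffsets false d₀ d₁) dirs} tt
ringOffsets-complete false d₀ d₂ _ = toWitness {a? = All.all? (_∈? ringOffsets false d₀ d₂) dirs} tt
ringOffsets-complete false d₁ d₀ _ = toWitness {a? = All.all? (_∈? ringOffsets false d₁ d₀) dirs} tt
ringOffsets-complete false d₁ d₂ _ = toWitness {a? = All.all? (_∈? ringOffsets false d₁ d₂) dirs} tt
ringOffsets-complete false d₂ d₀ _ = toWitness {a? = All.all? (_∈? ringOffsets false d₂ d₀) dirs} tt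
ringOffsets-complete false d₂ d₁ _ = toWitness {a? = All.all? (_∈? ringOffsets false d₂ d₁) dirs} tt
ringOffsets-complete true  d₀ d₁ _ = toWitness {a? = All.all? (_∈? ringOffsets true d₀ d₁) dirs} tt
ringOffsets-complete true  d₀ d₂ _ = toWitness {a? = All.all? (_∈? ringOffsets true d₀ d₂) dirs} tt
ringOffsets-complete true  d₁ d₀ _ = toWitness {a? = All.all? (_∈? ringOffsets true d₁ d₀) dirs} tt
ringOffsets-complete true  d₁ d₂ _ = toWitness {a? = All.all? (_∈? ringOffsets true d₁ d₂) dirs} tt
ringOffsets-complete true  d₂ d₀ _ = toWitness {a? = All.all? (_∈? ringOffsets true d₂ d₀) dirs} tt
ringOffsets-complete true  d₂ d₁ _ = toWitness {a? = All.all? (_∈? ringOffsets true d₂ d₁) dirs} tt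
ringOffsets-complete _     d₀ d₀ p≢q = ⊥-elim (p≢q refl)
ringOffsets-complete _     d₁ d₁ p≢q = ⊥-elim (p≢q refl)
ringOffsets-complete _     d₂ d₂ p≢q = ⊥-elim (p≢q refl)

twice : ℕ → ℕ
twice zero    = zero
twice (suc k) = suc (suc (twice k))

module BoundaryWalk (K : List Hex) (c : ℕ → LVertex)
                    (boundary : ∀ x → BoundaryEdge K (c x) (c (suc x)))
                    (no-backtrack : ∀ x → c x ≢ c (suc (suc x))) where

  dir : ℕ → Dir
  dir x = proj₁ (∈nbrs⇒move (proj₁ (boundary x)))

  c-suc : ∀ x → c (suc x) ≡ move (c x) (dir x)
  c-suc x = proj₂ (∈nbrs⇒move (proj₁ (boundary x)))

  dir≢dir-suc : ∀ x → dir x ≢ dir (suc x)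
  dir≢dir-suc x same = no-backtrack x (sym (begin
    c (suc (suc x))                   ≡⟨ c-suc (suc x) ⟩
    move (c (suc x)) (dir (suc x))    ≡⟨ cong₂ move (c-suc x) (sym same) ⟩
    move (move (c x) (dir x)) (dir x) ≡⟨ move-involutive (c x) (dir x) ⟩
    c x                               ∎))
    where open ≡-Reasoning

  opposite∈K : ℕ → Dir → Bool
  opposite∈K x m = opposite (c x) m ∈ᵇH K

  degree2 : ℕ → Bool
  degree2 x = baseDeg K (c x) ≡ᵇ 2

  edge-out : ∀ x → edgeCount (opposite∈K x) (dir x) ≡ 1
  edge-out x = trans (sym (kCount-move K (c x) (dir x)))
                     (subst (λ w → kCount K (c x) w ≡ 1) (c-suc x) (proj₂ (boundary x)))

  edge-in : ∀ x → edgeCount (opposite∈K (suc x)) (dir x) ≡ 1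
  edge-in x = trans (cong (λ w → edgeCount ((_∈ᵇH K) ∘ opposite w) (dir x)) (c-suc x))
                    (trans (edgeCount-move (_∈ᵇH K) (c x) (dir x)) (edge-out x))

  turn : ℕ → Dir
  turn x = third (dir x) (dir (suc x))

  -- The hexagon at c (suc x) between the edges by which the walk enters and leaves it.
  turnHex : ℕ → Hex
  turnHex x = opposite (c (suc x)) (turn x)

  corner-at : ∀ x → Corner (turnHex x ∈ᵇH K) (opposite∈K (suc x) (dir (suc x))) (opposite∈K (suc x) (dir x))
  corner-at x = corner
    (trans (sym (edgeCount-corner f (dir x) (dir (suc x)) (dir≢dir-suc x))) (edge-in x))
    (trans (sym edgeCount-corner′) (edge-out (suc x)))
    where
    f : Dir → Bool
    f = opposite∈K (suc x)
    edgeCount-corner′ : edgeCount f (dir (suc x)) ≡ bit (f (turn x)) + bit (f (dir x))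
    edgeCount-corner′ = trans (edgeCount-corner f (dir (suc x)) (dir x) (dir≢dir-suc x ∘ sym))
                              (cong (λ t → bit (f t) + bit (f (dir x))) (third-comm (dir (suc x)) (dir x)))

  degree2≡turnHex∈K : ∀ x → degree2 (suc x) ≡ turnHex x ∈ᵇH K
  degree2≡turnHex∈K x = trans (cong (_≡ᵇ 2) (baseDeg-opposite K (c (suc x))))
                              (degreeOf-corner (opposite∈K (suc x)) (dir x) (dir (suc x)) (dir≢dir-suc x) (corner-at x))

  turnHex-suc : ∀ x → dir (suc (suc x)) ≡ turn x → turnHex (suc x) ≡ turnHex x
  turnHex-suc x dir≡turn = sym (begin
    opposite (c (suc x)) (turn x)
      ≡⟨ opposite-move (c (suc x)) (third≢ʳ (dir x) (dir (suc x)) (dir≢dir-suc x)) ⟩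
    opposite (move (c (suc x)) (dir (suc x))) (third (dir (suc x)) (turn x))
      ≡⟨ cong₂ (λ w t → opposite w (third (dir (suc x)) t)) (sym (c-suc (suc x))) (sym dir≡turn) ⟩
    turnHex (suc x) ∎)
    where open ≡-Reasoning

  dir-suc-suc : ∀ x → dir (suc (suc x)) ≡ dir x ⊎ dir (suc (suc x)) ≡ turn x
  dir-suc-suc x = third-cases (dir x) (dir (suc x)) (dir (suc (suc x)))
                              (dir≢dir-suc x) (dir≢dir-suc (suc x) ∘ sym)

  side-suc : ∀ x → side (c (suc x)) ≡ not (side (c x))
  side-suc x = trans (cong side (c-suc x)) (side-move (c x) (dir x))

  zigzag-dir : (∀ x → degree2 (suc (suc x)) ≡ not (degree2 (suc x))) → ∀ x → dir (suc (suc x)) ≡ dir x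
  zigzag-dir alternating x with dir-suc-suc x
  ... | inj₁ straight = straight
  ... | inj₂ turning  = ⊥-elim (not-¬ (sym same-degree) (alternating x))
    where
    same-degree : degree2 (suc x) ≡ degree2 (suc (suc x))
    same-degree = trans (degree2≡turnHex∈K x)
                        (trans (cong (_∈ᵇH K) (sym (turnHex-suc x turning))) (sym (degree2≡turnHex∈K (suc x))))

  rotation-dir : (∀ x → degree2 (suc x) ≡ false) → ∀ x → dir (suc (suc x)) ≡ turn x
  rotation-dir no-degree2 x with dir-suc-suc x
  ... | inj₂ turning  = turning
  ... | inj₁ straight = case trans (sym in-K) (trans (cong (_∈ᵇH K) is-next-turnHex) (not-in-K (suc x))) of λ ()
    where
    not-in-K : ∀ y → turnHex y ∈ᵇH K ≡ false
    not-in-K y = trans (sym (degree2≡turnHex∈K y)) (no-degree2 y)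
    in-K : opposite∈K (suc x) (dir x) ≡ true
    in-K = proj₂ (corner-reflex (corner-at x) (not-in-K x))
    is-next-turnHex : opposite (c (suc x)) (dir x) ≡ turnHex (suc x)
    is-next-turnHex = trans (opposite-move (c (suc x)) (dir≢dir-suc x))
      (cong₂ (λ w t → opposite w (third (dir (suc x)) t)) (sym (c-suc (suc x))) (sym straight))

  module Rotation (no-degree2 : ∀ x → degree2 (suc x) ≡ false) where

    turnHex∉K : ∀ x → turnHex x ∈ᵇH K ≡ false
    turnHex∉K x = trans (sym (degree2≡turnHex∈K x)) (no-degree2 x)

    turnHex-const : ∀ x → turnHex x ≡ turnHex 0
    turnHex-const zero    = refl
    turnHex-const (suc x) = trans (turnHex-suc x (rotation-dir no-degree2 x)) (turnHex-const x)

    dir-seq : ∀ x → dir x ≡ rotationDirs (dir 0) (dir 1) x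
    dir-seq zero          = refl
    dir-seq (suc zero)    = refl
    dir-seq (suc (suc x)) = trans (rotation-dir no-degree2 x) (cong₂ third (dir-seq x) (dir-seq (suc x)))

    side-seq : ∀ x → side (c (suc x)) ≡ alternate (side (c 1)) x
    side-seq zero    = refl
    side-seq (suc x) = trans (side-suc (suc x)) (cong not (side-seq x))

    neighbour-in-K : ∀ x m → m ≢ turn x → opposite∈K (suc x) m ≡ true →
                     (turnHex 0 ⊕ offset (side (c (suc x))) (turn x) m) ∈ᵇH K ≡ true
    neighbour-in-K x m m≢turn in-K = trans (cong (_∈ᵇH K) (sym (begin
      opposite (c (suc x)) m                                ≡⟨ opposite-offset (c (suc x)) (turn x) m m≢turn ⟩
      turnHex x ⊕ offset (side (c (suc x))) (turn x) m
        ≡⟨ cong (_⊕ offset (side (c (suc x))) (turn x) m) (turnHex-const x) ⟩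
      turnHex 0 ⊕ offset (side (c (suc x))) (turn x) m     ∎))) in-K
      where open ≡-Reasoning

    ring-in-K : All (λ e → (turnHex 0 ⊕ e) ∈ᵇH K ≡ true) (ringOffsets (side (c 1)) (dir 0) (dir 1))
    ring-in-K = concat⁺ (map⁺ (universal step-in-K (upTo 6)))
      where
      step-in-K : ∀ x → All (λ e → (turnHex 0 ⊕ e) ∈ᵇH K ≡ true)
                            (ringStep (alternate (side (c 1)) x) (rotationDirs (dir 0) (dir 1) x)
                                      (rotationDirs (dir 0) (dir 1) (suc x)))
      step-in-K x rewrite sym (side-seq x) | sym (dir-seq x) | sym (dir-seq (suc x)) =
        neighbour-in-K x (dir x) (third≢ˡ (dir x) (dir (suc x)) (dir≢dir-suc x) ∘ sym) (proj₂ sides)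
        All.∷ neighbour-in-K x (dir (suc x)) (third≢ʳ (dir x) (dir (suc x)) (dir≢dir-suc x) ∘ sym) (proj₁ sides)
        All.∷ All.[]
        where
        sides : opposite∈K (suc x) (dir (suc x)) ≡ true × opposite∈K (suc x) (dir x) ≡ true
        sides = corner-reflex (corner-at x) (turnHex∉K x)

    turnHex-hole : SingleHexHole K (turnHex 0)
    turnHex-hole = (λ T∈K → case trans (sym (∈⇒∈ᵇH K T∈K)) (turnHex∉K 0) of λ ()) , only-turnHex
      where
      start : ∀ {h h′} → ReachOut K h h′ → h ∉ K
      start (here h∉K)     = h∉K
      start (step h∉K _ _) = h∉K
      only-turnHex : ∀ h → ReachOut K (turnHex 0) h → h ≡ turnHex 0
      only-turnHex h (here _)          = refl
      only-turnHex h (step _ adj rest) with find adj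
      ... | d , d∈dirs , h₁≡ = ⊥-elim (start rest (subst (_∈ K) (sym h₁≡)
              (∈ᵇH⇒∈ K (All.lookup ring-in-K (All.lookup (ringOffsets-complete _ _ _ (dir≢dir-suc 0)) d∈dirs)))))

  module Zigzag (alternating : ∀ x → degree2 (suc (suc x)) ≡ not (degree2 (suc x))) where

    dir-even : ∀ k → dir (twice k) ≡ dir 0 × dir (suc (twice k)) ≡ dir 1
    dir-even zero    = refl , refl
    dir-even (suc k) = trans (zigzag-dir alternating (twice k)) (proj₁ (dir-even k))
                     , trans (zigzag-dir alternating (suc (twice k))) (proj₂ (dir-even k))

    side-even : ∀ k → side (c (twice k)) ≡ side (c 0)
    side-even zero    = refl
    side-even (suc k) = trans (trans (side-suc (suc (twice k))) (cong not (side-suc (twice k))))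
                              (trans (not-involutive _) (side-even k))

    stride : Hex
    stride = offset (side (c 0)) (dir 0) (dir 1)

    stride-even : ∀ k → offset (side (c (twice k))) (dir (twice k)) (dir (suc (twice k))) ≡ stride
    stride-even k rewrite side-even k | proj₁ (dir-even k) | proj₂ (dir-even k) = refl

    cell-even : ∀ k → cell (c (twice k)) ≡ cell (c 0) ⊕ (k · stride)
    cell-even zero    = cong₂ _,_ (x≡x+0 _) (x≡x+0 _)
    cell-even (suc k) = begin
      cell (c (suc (suc (twice k))))
        ≡⟨ cong cell (trans (c-suc (suc (twice k))) (cong (λ w → move w (dir (suc (twice k)))) (c-suc (twice k)))) ⟩
      cell (move (move (c (twice k)) (dir (twice k))) (dir (suc (twice k))))
        ≡⟨ cell-move² (c (twice k)) (dir (twice k)) (dir (suc (twice k))) ⟩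
      cell (c (twice k)) ⊕ offset (side (c (twice k))) (dir (twice k)) (dir (suc (twice k)))
        ≡⟨ cong₂ _⊕_ (cell-even k) (stride-even k) ⟩
      (cell (c 0) ⊕ (k · stride)) ⊕ stride
        ≡⟨ ⊕-·-suc (cell (c 0)) k stride ⟩
      cell (c 0) ⊕ (suc k · stride) ∎
      where open ≡-Reasoning

    never-returns : ∀ m → c (twice (suc m)) ≢ c 0
    never-returns m eq = ⊕-·-suc≢ (cell (c 0)) m stride (offset≢0 _ _ _ (dir≢dir-suc 0))
                                   (trans (sym (cell-even (suc m))) (cong cell eq))

-- Marked positions on a cyclic list

-- cyclicSuc and segment are the functions nxt and seg local to altan.
cyclicSuc : ℕ → ℕ → ℕ
cyclicSuc d i = if suc i ≡ᵇ d then 0 else suc i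

cyclicSuc-≢ : ∀ {d i} → suc i ≢ d → cyclicSuc d i ≡ suc i
cyclicSuc-≢ {d} {i} ne rewrite dec-false (suc i ≟ d) ne = refl

cyclicSuc-≡ : ∀ {d i} → suc i ≡ d → cyclicSuc d i ≡ 0
cyclicSuc-≡ {d} {i} eq rewrite dec-true (suc i ≟ d) eq = refl

segment : ∀ {A : Set} → List A → ℕ → ℕ → List A
segment C c n = if c <ᵇ n then take (n ∸ c + 1) (drop c C) else drop c C ++ take (n + 1) C

<ᵇ-false : ∀ {m n} → n ≤ m → (m <ᵇ n) ≡ false
<ᵇ-false {_}     {zero}  _         = refl
<ᵇ-false {suc m} {suc n} (s≤s n≤m) = <ᵇ-false n≤m

length-take-≤ : ∀ {A : Set} k (xs : List A) → k ≤ length xs → length (take k xs) ≡ k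
length-take-≤ k xs k≤ = trans (length-take k xs) (m≤n⇒m⊓n≡m k≤)

length-segment-< : ∀ {A : Set} (C : List A) {c n} → c < n → n < length C → length (segment C c n) ≡ n ∸ c + 1
length-segment-< C {c} {n} c<n n<L rewrite Equivalence.to T-≡ (<⇒<ᵇ c<n) =
  length-take-≤ (n ∸ c + 1) (drop c C) (subst (n ∸ c + 1 ≤_) (sym (length-drop c C)) fits)
  where
  fits : n ∸ c + 1 ≤ length C ∸ c
  fits = subst (_≤ length C ∸ c) (trans (cong (_∸ c) (+-comm 1 n)) (+-∸-comm 1 (<⇒≤ c<n))) (∸-monoˡ-≤ c n<L)

length-segment-≥ : ∀ {A : Set} (C : List A) {c n e} → n ≤ c → c + e ≡ length C → n < length C →
                   length (segment C c n) ≡ suc n + e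
length-segment-≥ C {c} {n} {e} n≤c c+e≡L n<L rewrite <ᵇ-false n≤c = begin
  length (drop c C ++ take (n + 1) C)         ≡⟨ length-++ (drop c C) ⟩
  length (drop c C) + length (take (n + 1) C) ≡⟨ cong₂ _+_ drop-length (length-take-≤ (n + 1) C n+1≤L) ⟩
  e + (n + 1)                                 ≡⟨ trans (+-comm e (n + 1)) (cong (_+ e) (+-comm n 1)) ⟩
  suc n + e                                   ∎
  where
  open ≡-Reasoning
  n+1≤L : n + 1 ≤ length C
  n+1≤L = subst (_≤ length C) (+-comm 1 n) n<L
  drop-length : length (drop c C) ≡ e
  drop-length = trans (length-drop c C) (trans (cong (_∸ c) (sym c+e≡L)) (m+n∸m≡n c e))

range : ℕ → ℕ → List ℕ
range m zero    = []
range m (suc k) = m ∷ range (suc m) k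

range-∷ʳ : ∀ m k → range m k ∷ʳ (m + k) ≡ range m (suc k)
range-∷ʳ m zero    = cong (_∷ []) (+-identityʳ m)
range-∷ʳ m (suc k) = cong (m ∷_) (trans (cong (range (suc m) k ∷ʳ_) (+-suc m k)) (range-∷ʳ (suc m) k))

upTo≡range : ∀ n → upTo n ≡ range 0 n
upTo≡range zero    = refl
upTo≡range (suc n) = trans (sym (upTo-∷ʳ n)) (trans (cong (_∷ʳ n) (upTo≡range n)) (range-∷ʳ 0 n))

range-+ : ∀ m a b → range m (a + b) ≡ range m a ++ range (m + a) b
range-+ m zero    b = cong (λ x → range x b) (sym (+-identityʳ m))
range-+ m (suc a) b = cong (m ∷_) (trans (range-+ (suc m) a b)
                                         (cong (λ x → range (suc m) a ++ range x b) (sym (+-suc m a))))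

at-++ : ∀ xs ys k → at (xs ++ ys) (k + length xs) ≡ at ys k
at-++ []       ys k = cong (at ys) (+-identityʳ k)
at-++ (x ∷ xs) ys k = trans (cong (at (x ∷ xs ++ ys)) (+-suc k (length xs))) (at-++ xs ys k)

at-cyclicSuc-∷ : ∀ xs {j n ns} → let ps = xs ++ j ∷ n ∷ ns in at ps (cyclicSuc (length ps) (length xs)) ≡ n
at-cyclicSuc-∷ xs {j} {n} {ns} = trans (cong (at (xs ++ j ∷ n ∷ ns)) (cyclicSuc-≢ not-last)) (at-++ xs (j ∷ n ∷ ns) 1)
  where
  not-last : suc (length xs) ≢ length (xs ++ j ∷ n ∷ ns)
  not-last eq = m≢1+m+n (suc (length xs))
    (trans eq (trans (length-++ xs) (trans (+-suc (length xs) _) (cong suc (+-suc (length xs) _)))))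

at-cyclicSuc-∷ʳ : ∀ xs {j} → let ps = xs ∷ʳ j in at ps (cyclicSuc (length ps) (length xs)) ≡ at ps 0
at-cyclicSuc-∷ʳ xs {j} = cong (at (xs ∷ʳ j)) (cyclicSuc-≡ (sym (trans (length-++ xs) (+-comm (length xs) 1))))

∷ʳ-head : ∀ xs {j} → xs ∷ʳ j ≡ at (xs ∷ʳ j) 0 ∷ drop 1 (xs ∷ʳ j)
∷ʳ-head []      = refl
∷ʳ-head (_ ∷ _) = refl

module _ (F : ℕ → Bool) where

  record LeastTrue (m k n : ℕ) : Set where
    field
      lower  : m ≤ n
      upper  : n < m + k
      holds  : F n ≡ true
      before : ∀ z → m ≤ z → z < n → F z ≡ false

  filter-range-∷ : ∀ m k {n ns} → filterᵇ F (range m k) ≡ n ∷ ns → LeastTrue m k n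
  filter-range-∷ m (suc k) {n} eq with F m in Fm
  ... | true with refl ← eq = record
    { lower = ≤-refl ; upper = m<m+n m z<s ; holds = Fm ; before = λ z m≤z z<m → ⊥-elim (≤⇒≯ m≤z z<m) }
  ... | false = record
    { lower = ≤-trans (n≤1+n m) lower ; upper = subst (n <_) (sym (+-suc m k)) upper ; holds = holds ; before = before′ }
    where
    open LeastTrue (filter-range-∷ (suc m) k eq)
    before′ : ∀ z → m ≤ z → z < n → F z ≡ false
    before′ z m≤z z<n with m≤n⇒m<n∨m≡n m≤z
    ... | inj₁ m<z    = before z m<z z<n
    ... | inj₂ refl   = Fm

  filter-range-[] : ∀ m k → filterᵇ F (range m k) ≡ [] → ∀ z → m ≤ z → z < m + k → F z ≡ false
  filter-range-[] m zero    _  z m≤z z<m+0 = ⊥-elim (≤⇒≯ m≤z (subst (z <_) (+-identityʳ m) z<m+0))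
  filter-range-[] m (suc k) eq z m≤z z<m+k with F m in Fm
  ... | false with m≤n⇒m<n∨m≡n m≤z
  ...   | inj₁ m<z  = filter-range-[] (suc m) k eq z m<z (subst (z <_) (+-suc m k) z<m+k)
  ...   | inj₂ refl = Fm

  filter-upTo-split : ∀ j r → F j ≡ true →
    filterᵇ F (upTo (suc j + r)) ≡ filterᵇ F (range 0 j) ++ j ∷ filterᵇ F (range (suc j) r)
  filter-upTo-split j r Fj = begin
    filterᵇ F (upTo (suc j + r))                            ≡⟨ cong (filterᵇ F) (upTo≡range (suc j + r)) ⟩
    filterᵇ F (range 0 (suc j + r))                         ≡⟨ cong (λ n → filterᵇ F (range 0 n)) (sym (+-suc j r)) ⟩
    filterᵇ F (range 0 (j + suc r))                         ≡⟨ cong (filterᵇ F) (range-+ 0 j (suc r)) ⟩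
    filterᵇ F (range 0 j ++ j ∷ range (suc j) r)            ≡⟨ filter-++ (T? ∘ F) (range 0 j) _ ⟩
    filterᵇ F (range 0 j) ++ filterᵇ F (j ∷ range (suc j) r)
      ≡⟨ cong (filterᵇ F (range 0 j) ++_) (filter-accept (T? ∘ F) (Equivalence.from T-≡ Fj)) ⟩
    filterᵇ F (range 0 j) ++ j ∷ filterᵇ F (range (suc j) r) ∎
    where open ≡-Reasoning

wrap-cases : ∀ n e → 0 < e → suc n + e ≡ 3 → (n ≡ 1 × e ≡ 1) ⊎ (n ≡ 0 × e ≡ 2)
wrap-cases zero          e _   eq = inj₂ (refl , suc-injective eq)
wrap-cases (suc zero)    e _   eq = inj₁ (refl , suc-injective (suc-injective eq))
wrap-cases (suc (suc n)) e 0<e eq =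
  ⊥-elim (<⇒≢ 0<e (sym (m+n≡0⇒n≡0 n (suc-injective (suc-injective (suc-injective eq))))))

-- SegmentsOfLength3 ps says that from each position in ps to the next one (cyclically) C has three vertices,
-- which is what makes the new faces of an altan hexagons.
module CyclicPositions {A : Set} (C : List A) .{{_ : NonZero (length C)}} (F : ℕ → Bool) where

  L : ℕ
  L = length C

  positions : List ℕ
  positions = filterᵇ F (upTo L)

  SegmentsOfLength3 : List ℕ → Set
  SegmentsOfLength3 ps = ∀ i → i < length ps → length (segment C (at ps i) (at ps (cyclicSuc (length ps) i))) ≡ 3

  no-positions : positions ≡ [] → ∀ j → j < L → F j ≡ false
  no-positions eq j j<L = filter-range-[] F 0 L (trans (cong (filterᵇ F) (sym (upTo≡range L))) eq) j z≤n j<L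

  first-position : ∀ {n ns} → positions ≡ n ∷ ns → LeastTrue F 0 L n
  first-position eq = filter-range-∷ F 0 L (trans (cong (filterᵇ F) (sym (upTo≡range L))) eq)

  positions-split : ∀ {j} → j < L → F j ≡ true →
    positions ≡ filterᵇ F (range 0 j) ++ j ∷ filterᵇ F (range (suc j) (L ∸ suc j))
  positions-split {j} j<L Fj =
    trans (cong (λ n → filterᵇ F (upTo n)) (sym (m+[n∸m]≡n j<L))) (filter-upTo-split F j (L ∸ suc j) Fj)

  segment-from : SegmentsOfLength3 positions → ∀ earlier {j} later → positions ≡ earlier ++ j ∷ later →
    let ps = earlier ++ j ∷ later in length (segment C j (at ps (cyclicSuc (length ps) (length earlier)))) ≡ 3
  segment-from segs earlier {j} later eq =
    subst (λ c → length (segment C c (at ps (cyclicSuc (length ps) (length earlier)))) ≡ 3) (at-++ earlier (j ∷ later) 0)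
          (subst SegmentsOfLength3 eq segs (length earlier)
                 (subst (length earlier <_) (sym (length-++ earlier)) (m<m+n (length earlier) z<s)))
    where
    ps : List ℕ
    ps = earlier ++ j ∷ later

  spacing-inner : ∀ {j n} → j < L → LeastTrue F (suc j) (L ∸ suc j) n → length (segment C j n) ≡ 3 →
                  F (suc j % L) ≡ false × F (suc (suc j) % L) ≡ true
  spacing-inner {j} {n} j<L least seg3 =
    subst (λ x → F x ≡ false) (sym (m<n⇒m%n≡m (<⇒≤ n<L′)))
          (before (suc j) ≤-refl (subst (suc j <_) (sym n≡) ≤-refl))
    , subst (λ x → F x ≡ true) (sym (trans (cong (_% L) (sym n≡)) (m<n⇒m%n≡m n<L))) holds
    where
    open LeastTrue least
    n<L : n < L
    n<L = subst (n <_) (m+[n∸m]≡n j<L) upper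
    j<n : j < n
    j<n = lower
    n∸j≡2 : n ∸ j ≡ 2
    n∸j≡2 = +-cancelʳ-≡ 1 (n ∸ j) 2 (trans (sym (length-segment-< C j<n n<L)) seg3)
    n≡ : n ≡ suc (suc j)
    n≡ = trans (sym (m+[n∸m]≡n (<⇒≤ j<n))) (trans (cong (λ x → j + x) n∸j≡2) (+-comm j 2))
    n<L′ : suc (suc j) < L
    n<L′ = subst (_< L) n≡ n<L

  spacing-wrap : ∀ {j n₀} → 3 ≤ L → j < L → F j ≡ true → LeastTrue F 0 L n₀ →
                 filterᵇ F (range (suc j) (L ∸ suc j)) ≡ [] → length (segment C j n₀) ≡ 3 →
                 F (suc j % L) ≡ false × F (suc (suc j) % L) ≡ true
  spacing-wrap {j} {n₀} L≥3 j<L Fj first none-later seg3 =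
    by-cases (wrap-cases n₀ (L ∸ j) (m<n⇒0<n∸m j<L) seg-length)
    where
    open LeastTrue first
    n₀≤j : n₀ ≤ j
    n₀≤j = ≮⇒≥ (λ j<n₀ → case trans (sym Fj) (before j z≤n j<n₀) of λ ())
    seg-length : suc n₀ + (L ∸ j) ≡ 3
    seg-length = trans (sym (length-segment-≥ C n₀≤j (m+[n∸m]≡n (<⇒≤ j<L)) upper)) seg3
    L≡j+ : ∀ {e} → L ∸ j ≡ e → L ≡ j + e
    L≡j+ eq = trans (sym (m+[n∸m]≡n (<⇒≤ j<L))) (cong (λ x → j + x) eq)
    by-cases : (n₀ ≡ 1 × L ∸ j ≡ 1) ⊎ (n₀ ≡ 0 × L ∸ j ≡ 2) →
               F (suc j % L) ≡ false × F (suc (suc j) % L) ≡ true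
    by-cases (inj₁ (n₀≡1 , L∸j≡1)) =
      subst (λ x → F x ≡ false) (sym (trans (cong (_% L) suc-j≡L) (n%n≡0 L)))
            (before 0 z≤n (subst (0 <_) (sym n₀≡1) z<s))
      , subst (λ x → F x ≡ true) (sym suc-suc-j%L≡n₀) holds
      where
      suc-j≡L : suc j ≡ L
      suc-j≡L = sym (trans (L≡j+ L∸j≡1) (+-comm j 1))
      suc-suc-j%L≡n₀ : suc (suc j) % L ≡ n₀
      suc-suc-j%L≡n₀ = begin
        suc (suc j) % L ≡⟨ cong (λ x → suc x % L) suc-j≡L ⟩
        (1 + L) % L     ≡⟨ [m+n]%n≡m%n 1 L ⟩
        1 % L           ≡⟨ m<n⇒m%n≡m (≤-trans (s≤s (s≤s z≤n)) L≥3) ⟩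
        1               ≡⟨ sym n₀≡1 ⟩
        n₀              ∎
        where open ≡-Reasoning
    by-cases (inj₂ (n₀≡0 , L∸j≡2)) =
      subst (λ x → F x ≡ false) (sym (m<n⇒m%n≡m suc-j<L))
            (filter-range-[] F (suc j) (L ∸ suc j) none-later (suc j) ≤-refl
                             (subst (suc j <_) (sym (m+[n∸m]≡n j<L)) suc-j<L))
      , subst (λ x → F x ≡ true) (sym (trans (cong (_% L) suc-suc-j≡L) (trans (n%n≡0 L) (sym n₀≡0)))) holds
      where
      suc-suc-j≡L : suc (suc j) ≡ L
      suc-suc-j≡L = sym (trans (L≡j+ L∸j≡2) (+-comm j 2))
      suc-j<L : suc j < L
      suc-j<L = ≤-reflexive suc-suc-j≡L

  spacing : 3 ≤ L → SegmentsOfLength3 positions → ∀ {j} → j < L → F j ≡ true →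
            F (suc j % L) ≡ false × F (suc (suc j) % L) ≡ true
  spacing L≥3 segs {j} j<L Fj with filterᵇ F (range (suc j) (L ∸ suc j)) in later≡
  ... | n ∷ ns = spacing-inner j<L (filter-range-∷ F (suc j) (L ∸ suc j) later≡)
                   (subst (λ x → length (segment C j x) ≡ 3) (at-cyclicSuc-∷ earlier)
                          (segment-from segs earlier (n ∷ ns) split))
    where
    earlier : List ℕ
    earlier = filterᵇ F (range 0 j)
    split : positions ≡ earlier ++ j ∷ n ∷ ns
    split = trans (positions-split j<L Fj) (cong (λ l → earlier ++ j ∷ l) later≡)
  ... | [] = spacing-wrap L≥3 j<L Fj (first-position (trans split (∷ʳ-head earlier))) later≡
               (subst (λ x → length (segment C j x) ≡ 3) (at-cyclicSuc-∷ʳ earlier)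
                      (segment-from segs earlier [] split))
    where
    earlier : List ℕ
    earlier = filterᵇ F (range 0 j)
    split : positions ≡ earlier ++ j ∷ []
    split = trans (positions-split j<L Fj) (cong (λ l → earlier ++ j ∷ l) later≡)

-- The first altan operation on a perimeter

index : ∀ {A : Set} → A → List A → ℕ → A
index d []       _       = d
index d (x ∷ xs) zero    = x
index d (x ∷ xs) (suc j) = index d xs j

module _ {A : Set} (d : A) where

  index-∈ : ∀ xs {j} → j < length xs → index d xs j ∈ xs
  index-∈ (x ∷ xs) {zero}  _         = here refl
  index-∈ (x ∷ xs) {suc j} (s≤s j<n) = there (index-∈ xs j<n)

  index-injective : ∀ {xs} → Unique xs → ∀ {i j} → i < length xs → j < length xs →
                    index d xs i ≡ index d xs j → i ≡ j
  index-injective {x ∷ xs} _ {zero}  {zero}  _ _ _ = refl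
  index-injective {x ∷ xs} (x∉ AllPairs.∷ _) {zero}  {suc j} _ (s≤s j<n) eq =
    ⊥-elim (All.lookup x∉ (index-∈ xs j<n) eq)
  index-injective {x ∷ xs} (x∉ AllPairs.∷ _) {suc i} {zero}  (s≤s i<n) _ eq =
    ⊥-elim (All.lookup x∉ (index-∈ xs i<n) (sym eq))
  index-injective {x ∷ xs} (_ AllPairs.∷ u) {suc i} {suc j} (s≤s i<n) (s≤s j<n) eq =
    cong suc (index-injective u i<n j<n eq)

  index-zip : ∀ {P : A × A → Set} xs ys {j} → All P (zip xs ys) → j < length xs → j < length ys →
              P (index d xs j , index d ys j)
  index-zip (x ∷ xs) (y ∷ ys) {zero}  (p ∷ _)  _ _ = p
  index-zip (x ∷ xs) (y ∷ ys) {suc j} (_ ∷ ps) (s≤s j<m) (s≤s j<n) = index-zip xs ys ps j<m j<n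

  index-++ : ∀ xs ys {j} → j < length xs → index d (xs ++ ys) j ≡ index d xs j
  index-++ (x ∷ xs) ys {zero}  _         = refl
  index-++ (x ∷ xs) ys {suc j} (s≤s j<n) = index-++ xs ys j<n

  index-length : ∀ xs y → index d (xs ++ y ∷ []) (length xs) ≡ y
  index-length []       y = refl
  index-length (x ∷ xs) y = index-length xs y

%-suc : ∀ m n .{{_ : NonZero n}} → suc m % n ≡ suc (m % n) % n
%-suc m n = trans (cong (λ x → suc x % n) (m≡m%n+[m/n]*n m n)) ([m+kn]%n≡m%n (suc (m % n)) (m / n) n)

suc-suc-%≢ : ∀ {j L} .{{_ : NonZero L}} → 3 ≤ L → j < L → suc (suc j) % L ≢ j
suc-suc-%≢ {j} {L} L≥3 j<L eq with suc (suc j) <? L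
... | yes 2+j<L = <⇒≢ (m<n⇒m<1+n (n<1+n j)) (sym (trans (sym (m<n⇒m%n≡m 2+j<L)) eq))
... | no  2+j≮L = ≤⇒≯ (subst (3 ≤_) L≡2 L≥3) ≤-refl
  where
  L≤2+j : L ≤ suc (suc j)
  L≤2+j = ≮⇒≥ 2+j≮L
  t<L : suc (suc j) ∸ L < L
  t<L = ≤-<-trans (≤-trans (∸-monoʳ-≤ (suc (suc j)) L≥3) (m∸n≤m j 1)) j<L
  t≡j : suc (suc j) ∸ L ≡ j
  t≡j = trans (sym (m<n⇒m%n≡m t<L)) (trans (m≤n⇒[n∸m]%m≡n%m L≤2+j) eq)
  L≡2 : L ≡ 2
  L≡2 = +-cancelˡ-≡ j L 2 (trans (cong (_+ L) (sym t≡j)) (trans (m∸n+n≡m L≤2+j) (+-comm 2 j)))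

module PerimeterWalk (K : List Hex) (v₀ : LVertex) (rest : List LVertex) (cycle : IsBoundaryCycle K (v₀ ∷ rest))
                     (L : ℕ) .{{_ : NonZero L}} (length≡L : length (v₀ ∷ rest) ≡ L) (s : ℕ) where

  pos : ℕ → ℕ
  pos x = (s + x) % L

  walk : ℕ → LVertex
  walk x = index v₀ (v₀ ∷ rest) (pos x)

  pos<L : ∀ x → pos x < L
  pos<L x = m%n<n (s + x) L

  pos-suc : ∀ x → pos (suc x) ≡ suc (pos x) % L
  pos-suc x = trans (cong (_% L) (+-suc s x)) (%-suc (s + x) L)

  pos-suc-suc : ∀ x → pos (suc (suc x)) ≡ suc (suc (pos x)) % L
  pos-suc-suc x = trans (pos-suc (suc x)) (trans (cong (λ y → suc y % L) (pos-suc x)) (sym (%-suc (suc (pos x)) L)))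

  private
    <length : ∀ {j} → j < L → j < length (v₀ ∷ rest)
    <length = subst (_ <_) (sym length≡L)

    <length′ : ∀ {j} → j < L → j < length (rest ++ v₀ ∷ [])
    <length′ = subst (_ <_) (sym (trans (length-++ rest) (trans (+-comm (length rest) 1) length≡L)))

  next-in-cycle : ∀ j → j < L → index v₀ (rest ++ v₀ ∷ []) j ≡ index v₀ (v₀ ∷ rest) (suc j % L)
  next-in-cycle j j<L with m≤n⇒m<n∨m≡n (≤-pred (<length j<L))
  ... | inj₁ j<rest = trans (index-++ v₀ rest (v₀ ∷ []) j<rest)
                            (cong (index v₀ (v₀ ∷ rest)) (sym (m<n⇒m%n≡m (subst (suc j <_) length≡L (s≤s j<rest)))))
  ... | inj₂ refl   = trans (index-length v₀ rest v₀)
                            (cong (index v₀ (v₀ ∷ rest)) (sym (trans (cong (_% L) length≡L) (n%n≡0 L))))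

  boundary : ∀ x → BoundaryEdge K (walk x) (walk (suc x))
  boundary x = subst (BoundaryEdge K (walk x))
    (trans (next-in-cycle (pos x) (pos<L x)) (cong (index v₀ (v₀ ∷ rest)) (sym (pos-suc x))))
    (index-zip v₀ (v₀ ∷ rest) (rest ++ v₀ ∷ []) (proj₂ (proj₂ cycle)) (<length (pos<L x)) (<length′ (pos<L x)))

  no-backtrack : ∀ x → walk x ≢ walk (suc (suc x))
  no-backtrack x eq = suc-suc-%≢ (subst (3 ≤_) length≡L (proj₁ cycle)) (pos<L x)
    (trans (sym (pos-suc-suc x))
           (sym (index-injective v₀ (proj₁ (proj₂ cycle)) (<length (pos<L x)) (<length (pos<L (suc (suc x)))) eq)))

  twice-period : walk (twice L) ≡ walk 0
  twice-period = cong (index v₀ (v₀ ∷ rest)) (begin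
    (s + twice L) % L   ≡⟨ cong (λ n → (s + n) % L) (twice≡+ L) ⟩
    (s + (L + L)) % L   ≡⟨ cong (_% L) (sym (+-assoc s L L)) ⟩
    (s + L + L) % L     ≡⟨ [m+n]%n≡m%n (s + L) L ⟩
    (s + L) % L         ≡⟨ [m+n]%n≡m%n s L ⟩
    s % L               ≡⟨ cong (_% L) (sym (+-identityʳ s)) ⟩
    (s + 0) % L         ∎)
    where
    open ≡-Reasoning
    twice≡+ : ∀ k → twice k ≡ k + k
    twice≡+ zero    = refl
    twice≡+ (suc k) = cong suc (trans (cong suc (twice≡+ k)) (sym (+-suc k k)))

module _ (G : ℕ → Bool) (G0 : G 0 ≡ true)
         (step : ∀ x → G x ≡ true → G (suc x) ≡ false × G (suc (suc x)) ≡ true) where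

  phase : ∀ x → (G x ≡ true × G (suc x) ≡ false) ⊎ (G x ≡ false × G (suc x) ≡ true)
  phase zero = inj₁ (G0 , proj₁ (step 0 G0))
  phase (suc x) with phase x
  ... | inj₁ (now , next) = inj₂ (next , proj₂ (step x now))
  ... | inj₂ (_   , next) = inj₁ (next , proj₁ (step (suc x) next))

  alternates : ∀ x → G (suc x) ≡ not (G x)
  alternates x with phase x
  ... | inj₁ (now , next) = trans next (cong not (sym now))
  ... | inj₂ (now , next) = trans next (cong not (sym now))

take-1-drop-map : ∀ {A B : Set} (f : A → B) (d : A) xs {j} → j < length xs →
                  take 1 (drop j (map f xs)) ≡ f (index d xs j) ∷ []
take-1-drop-map f d (x ∷ xs) {zero}  _         = refl
take-1-drop-map f d (x ∷ xs) {suc j} (s≤s j<n) = take-1-drop-map f d xs j<n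

module FirstAltan (K : List Hex) (non-degenerate : NonDegenerate K) (p : ℕ)
                  (v₀ : LVertex) (rest : List LVertex) (cycle : IsBoundaryCycle K (v₀ ∷ rest)) where

  perimeter : List AVert
  perimeter = map inj₁ (v₀ ∷ rest)

  degree2At : ℕ → Bool
  degree2At j = any (λ v → deg K [] v ≡ᵇ 2) (take 1 (drop j perimeter))

  open CyclicPositions perimeter degree2At

  length≡L : length (v₀ ∷ rest) ≡ L
  length≡L = cong suc (sym (length-map inj₁ rest))

  degree2At-index : ∀ {j} → j < L → degree2At j ≡ (baseDeg K (index v₀ (v₀ ∷ rest) j) ≡ᵇ 2)
  degree2At-index {j} j<L = begin
    degree2At j
      ≡⟨ cong (any (λ v → deg K [] v ≡ᵇ 2))
              (take-1-drop-map inj₁ v₀ (v₀ ∷ rest) (subst (j <_) (sym length≡L) j<L)) ⟩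
    (deg K [] (inj₁ u) ≡ᵇ 2) ∨ false ≡⟨ ∨-identityʳ _ ⟩
    (baseDeg K u + 0 ≡ᵇ 2)           ≡⟨ cong (_≡ᵇ 2) (+-identityʳ (baseDeg K u)) ⟩
    (baseDeg K u ≡ᵇ 2)               ∎
    where
    open ≡-Reasoning
    u : LVertex
    u = index v₀ (v₀ ∷ rest) j

  faces : List (List AVert)
  faces = AltanResult.newFaces (altan K p 0 [] perimeter)

  hexagonal⇒segments : All IsHexagonFace faces → SegmentsOfLength3 positions
  hexagonal⇒segments hex i i<n = +-cancelʳ-≡ 3 _ 3
    (trans (sym (length-++ (segment perimeter (at positions i) (at positions (cyclicSuc (length positions) i)))))
           (All.lookup (map⁻ hex) (∈-upTo⁺ i<n)))

  no-degree2⇒hole : positions ≡ [] → ⊥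
  no-degree2⇒hole positions≡ = non-degenerate _ (Rotation.turnHex-hole no-degree2)
    where
    open PerimeterWalk K v₀ rest cycle L length≡L 0
    open BoundaryWalk K walk boundary no-backtrack
    no-degree2 : ∀ x → degree2 (suc x) ≡ false
    no-degree2 x = trans (sym (degree2At-index (pos<L (suc x)))) (no-positions positions≡ _ (pos<L (suc x)))

  spaced⇒zigzag : SegmentsOfLength3 positions → ∀ {n ns} → positions ≡ n ∷ ns → ⊥
  spaced⇒zigzag segs {n} positions≡ = Zigzag.never-returns alternating (length (map inj₁ rest)) twice-period
    where
    first : LeastTrue degree2At 0 L n
    first = first-position positions≡
    open PerimeterWalk K v₀ rest cycle L length≡L n
    open BoundaryWalk K walk boundary no-backtrack
    G : ℕ → Bool
    G x = degree2At (pos x)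
    degree2≡G : ∀ x → degree2 x ≡ G x
    degree2≡G x = sym (degree2At-index (pos<L x))
    starts : G 0 ≡ true
    starts = trans (cong degree2At (trans (cong (_% L) (+-identityʳ n)) (m<n⇒m%n≡m (LeastTrue.upper first))))
                   (LeastTrue.holds first)
    steps : ∀ x → G x ≡ true → G (suc x) ≡ false × G (suc (suc x)) ≡ true
    steps x Gx with spacing (subst (3 ≤_) length≡L (proj₁ cycle)) segs (pos<L x) Gx
    ... | next , next-next = trans (cong degree2At (pos-suc x)) next , trans (cong degree2At (pos-suc-suc x)) next-next
    alternating : ∀ x → degree2 (suc (suc x)) ≡ not (degree2 (suc x))
    alternating x = trans (degree2≡G _) (trans (alternates G starts steps (suc x)) (cong not (sym (degree2≡G _))))

  not-hexagonal : ¬ All IsHexagonFace faces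
  not-hexagonal hex = by-positions positions refl
    where
    by-positions : ∀ ps → positions ≡ ps → ⊥
    by-positions []      positions≡ = no-degree2⇒hole positions≡
    by-positions (_ ∷ _) positions≡ = spaced⇒zigzag (hexagonal⇒segments hex) positions≡

module _ {P : List AVert → Set} (K : List Hex) where

  runPos-faces⁻ : ∀ p n s E F C → All P (proj₂ (runPos K p n s (E , F) C)) → All P F
  runPos-faces⁻ p zero    s E F C all = all
  runPos-faces⁻ p (suc n) s E F C all = ++⁻ˡ F (runPos-faces⁻ p n (suc s) _ _ _ all)

  runAll-faces⁻ : ∀ p ns Cs st → All P (proj₂ (runAll K p ns Cs st)) → All P (proj₂ st)
  runAll-faces⁻ p []       Cs       st       all = all
  runAll-faces⁻ p (_ ∷ _)  []       st       all = all
  runAll-faces⁻ p (n ∷ ns) (C ∷ Cs) (E , F) all = runPos-faces⁻ p n 0 E F C (runAll-faces⁻ (suc p) ns Cs _ all)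

-- Only the first position with a nonzero count matters: before it nothing has been added to G(K).
runAll-not-hexagonal : ∀ K → NonDegenerate K → ∀ p Cs (ns : Vec ℕ (length Cs)) F →
  All (IsBoundaryCycle K) Cs → ns ≢ replicate (length Cs) 0 →
  ¬ All IsHexagonFace (proj₂ (runAll K p (toList ns) (map (map inj₁) Cs) ([] , F)))
runAll-not-hexagonal K nd p []       []             F _             ns≢0 _ = ns≢0 refl
runAll-not-hexagonal K nd p (C ∷ Cs) (zero ∷ ns)    F (_ ∷ cycles) ns≢0 =
  runAll-not-hexagonal K nd (suc p) Cs ns F cycles (ns≢0 ∘ cong (0 ∷_))
runAll-not-hexagonal K nd p ([] ∷ Cs) (suc k ∷ ns) F (() ∷ _) _
runAll-not-hexagonal K nd p ((v₀ ∷ rest) ∷ Cs) (suc k ∷ ns) F (cycle ∷ _) _ hex =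
  FirstAltan.not-hexagonal K nd p v₀ rest cycle
    (++⁻ʳ F (runPos-faces⁻ K p k 1 _ _ _ (runAll-faces⁻ K (suc p) (toList ns) (map (map inj₁) Cs) _ hex)))

proposition4p5 : (K : List Hex) → Coronoid K → NonDegenerate K →
    (Cs : List (List LVertex)) → Perimeters K Cs →
    (ns : Vec ℕ (length Cs)) → ¬ (ns ≡ replicate (length Cs) 0) →
    ¬ All IsHexagonFace (altanFaces K Cs ns)
proposition4p5 K _ nd Cs perimeters ns ns≢0 =
  runAll-not-hexagonal K nd 0 Cs ns (map (λ h → map inj₁ (corners h)) K) (proj₁ perimeters) ns≢0
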